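{- Let $(X,\leq)$ be a partial order and $U$ a predicate on $X$, and assume that induction holds for $U$ and $X$. If $U$ is meet-closed and good, then $U(x)$ holds for all $x\in X$.
   Context: For $x,y\in X$, $y>x$ means $y\geq x$ and $y\neq x$. A predicate $U$ on $X$ is progressive if for every $x\in X$: if $U(y)$ holds for all $y\in X$ with $y>x$, then $U(x)$ holds. "Induction holds for $U$ and $X$" means: if $U$ is progressive, then $U(x)$ holds for all $x\in X$. For $x,y,z\in X$, $x=y\wedge z$ means that $x$ is the greatest lower bound of $y$ and $z$, i.e. for all $x'\in X$, $x'\leq x$ iff ($x'\leq y$ and $x'\leq z$). An element $x\in X$ is reducible if there are $y,z\in X$ with $x<y$, $x<z$ and $x=y\wedge z$. $U$ is good if for every $x\in X$, either $U(x)$ holds or $x$ is reducible. $U$ is meet-closed if whenever $x=y\wedge z$ in $X$, $U(y)$ and $U(z)$ together imply $U(x)$. (The setting is intuitionistic logic.) -}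

module Defs where

open import Level using (Level; _⊔_; suc)
open import Data.Product using (Σ; _×_; ∃-syntax)
open import Data.Sum using (_⊎_)
open import Relation.Nullary using (¬_)
open import Relation.Binary.Bundles using (Poset)

module _ {c ℓ₁ ℓ₂ : Level} (P : Poset c ℓ₁ ℓ₂) where
  open Poset P renaming (Carrier to X)

  _>ᵖ_ : X → X → Set (ℓ₁ ⊔ ℓ₂)
  y >ᵖ x = (x ≤ y) × ¬ (y ≈ x)

  Progressive : ∀ {u} → (X → Set u) → Set (c ⊔ ℓ₁ ⊔ ℓ₂ ⊔ u)
  Progressive U = ∀ x → (∀ y → y >ᵖ x → U y) → U x

  InductionHolds : ∀ {u} → (X → Set u) → Set (c ⊔ ℓ₁ ⊔ ℓ₂ ⊔ u)
  InductionHolds U = Progressive U → ∀ x → U x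

  IsMeet : X → X → X → Set (c ⊔ ℓ₂)
  IsMeet x y z = ∀ x' → ((x' ≤ x → (x' ≤ y × x' ≤ z)) × ((x' ≤ y × x' ≤ z) → x' ≤ x))

  Reducible : X → Set (c ⊔ ℓ₁ ⊔ ℓ₂)
  Reducible x = ∃[ y ] ∃[ z ] (y >ᵖ x × z >ᵖ x × IsMeet x y z)

  Good : ∀ {u} → (X → Set u) → Set (c ⊔ ℓ₁ ⊔ ℓ₂ ⊔ u)
  Good U = ∀ x → U x ⊎ Reducible x

  MeetClosed : ∀ {u} → (X → Set u) → Set (c ⊔ ℓ₂ ⊔ u)
  MeetClosed U = ∀ x y z → IsMeet x y z → U y → U z → U x

module Submission where

open import Defs
open import Level using (Level)
open import Relation.Binary.Bundles using (Poset)
open import Data.Sum using (inj₁; inj₂)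
open import Data.Product using (_,_)

module _ {c ℓ₁ ℓ₂ u : Level} (P : Poset c ℓ₁ ℓ₂) {U : Poset.Carrier P → Set u} where

  good∧meetClosed⇒progressive : MeetClosed P U → Good P U → Progressive P U
  good∧meetClosed⇒progressive meetClosed good x U-above with good x
  ... | inj₁ Ux = Ux
  ... | inj₂ (y , z , y>x , z>x , x≡y∧z) =
    meetClosed x y z x≡y∧z (U-above y y>x) (U-above z z>x)

theorem4p2 : {c ℓ₁ ℓ₂ u : Level} (P : Poset c ℓ₁ ℓ₂) (U : Poset.Carrier P → Set u) →
    InductionHolds P U → MeetClosed P U → Good P U → ∀ x → U x
theorem4p2 P U induction meetClosed good =
  induction (good∧meetClosed⇒progressive P meetClosed good)
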